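{- Let $L$ and $L'$ be languages with value sets $\mathbf V$ and $\mathbf V'$, let $\mathbf Z\supseteq \mathbf V\cup\mathbf V'$, let $\sim$ be an equivalence relation on $\mathbf Z$, and let $T:\mathbb T_L\to\mathbb T_{L'}$ be a translation. Then $T$ is correct up to $\sim$ if and only if $T$ is valid up to $\sim$ and $\sim$ is a congruence for $T(L)$.
   Context: Fix a set $\mathcal V$ of variables. A language $L$ consists of a set $\mathbb T_L$ of expressions (built from variables in $\mathcal V$ by operators and possibly other constructs) and a semantic map $[\![\cdot]\!]_L:\mathbb T_L\to((\mathcal V\to\mathbf V)\to\mathbf V)$ for a set of values $\mathbf V$; maps $\rho:\mathcal V\to\mathbf V$ are valuations. Similarly $L'$ has $\mathbb T_{L'}$, $[\![\cdot]\!]_{L'}$ and values $\mathbf V'$. A translation is any map $T:\mathbb T_L\to\mathbb T_{L'}$. A semantic translation is a relation $R\subseteq\mathbf V'\times\mathbf V$ such that for every $v\in\mathbf V$ there is $v'\in\mathbf V'$ with $v' R v$. For valuations $\eta:\mathcal V\to\mathbf V'$, $\rho:\mathcal V\to\mathbf V$ write $\eta R\rho$ iff $\eta(X)R\rho(X)$ for all $X\in\mathcal V$ (similarly $\eta\sim\rho$). $T$ is correct w.r.t. $R$ if $[\![T(E)]\!]_{L'}(\eta)\,R\,[\![E]\!]_L(\rho)$ for all $E\in\mathbb T_L$ and all valuations $\eta,\rho$ with $\eta R\rho$. $T$ is correct up to an equivalence $\sim$ on $\mathbf Z$ if the restriction of $\sim$ to $\mathbf V'\times\mathbf V$ is a semantic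 translation and $T$ is correct w.r.t. it. $T$ is valid up to a preorder $\precsim$ on $\mathbf Z$ if $T$ is correct w.r.t. some semantic translation $R\subseteq\,\precsim$. Let $\mathbf U=\{v'\in\mathbf V'\mid\exists v\in\mathbf V.\ v'\sim v\}$. The equivalence $\sim$ is a congruence for $T(L)$ if $[\![T(E)]\!]_{L'}(\theta)\sim[\![T(E)]\!]_{L'}(\eta)$ for all $E\in\mathbb T_L$ and all $\theta,\eta:\mathcal V\to\mathbf U$ with $\theta\sim\eta$. -}

module Defs where

open import Level using (Level; _⊔_; suc)
open import Data.Product using (Σ; Σ-syntax; ∃; _×_; _,_; proj₁; proj₂)
open import Relation.Unary using (Pred)
open import Relation.Binary.Core using (Rel)

-- Ambient setting: a fixed set of variables 𝒱 (Var) and a universe of values Z.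
-- Value sets V ⊆ Z are given as predicates on Z; the values themselves are
-- the elements of the subtype  Σ Z V.

Val : ∀ {ℓ} {Z : Set ℓ} → Pred Z ℓ → Set ℓ
Val {Z = Z} V = Σ Z V

record Language {ℓ} (Var : Set ℓ) {Z : Set ℓ} (V : Pred Z ℓ) : Set (suc ℓ) where
  field
    Expr : Set ℓ
    ⟦_⟧  : Expr → (Var → Val V) → Val V

open Language public

module Translations {ℓ} {Var : Set ℓ} {Z : Set ℓ}
  {V V′ : Pred Z ℓ} (L : Language Var V) (L′ : Language Var V′) where

  Translation : Set ℓ
  Translation = Expr L → Expr L′

  VRel : Set (suc ℓ)
  VRel = Val V′ → Val V → Set ℓ

  IsSemanticTranslation : VRel → Set ℓ
  IsSemanticTranslation R = ∀ (v : Val V) → Σ[ v′ ∈ Val V′ ] R v′ v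

  _⟨_⟩ᵛ_ : (Var → Val V′) → VRel → (Var → Val V) → Set ℓ
  η ⟨ R ⟩ᵛ ρ = ∀ (X : Var) → R (η X) (ρ X)

  CorrectWrt : Translation → VRel → Set ℓ
  CorrectWrt T R = ∀ (E : Expr L) (η : Var → Val V′) (ρ : Var → Val V) →
    η ⟨ R ⟩ᵛ ρ → R (⟦ L′ ⟧ (T E) η) (⟦ L ⟧ E ρ)

  restrict : Rel Z ℓ → VRel
  restrict _∼_ v′ v = proj₁ v′ ∼ proj₁ v

  CorrectUpTo : Translation → Rel Z ℓ → Set ℓ
  CorrectUpTo T _∼_ = IsSemanticTranslation (restrict _∼_) × CorrectWrt T (restrict _∼_)

  ValidUpTo : Translation → Rel Z ℓ → Set (suc ℓ)
  ValidUpTo T _≾_ = Σ[ R ∈ VRel ]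
    ( IsSemanticTranslation R
    × (∀ v′ v → R v′ v → proj₁ v′ ≾ proj₁ v)
    × CorrectWrt T R )

  U : Rel Z ℓ → Set ℓ
  U _∼_ = Σ[ v′ ∈ Val V′ ] Σ[ v ∈ Val V ] proj₁ v′ ∼ proj₁ v

  IsCongruenceFor : Rel Z ℓ → Translation → Set ℓ
  IsCongruenceFor _∼_ T = ∀ (E : Expr L) (θ η : Var → U _∼_) →
    (∀ (X : Var) → proj₁ (proj₁ (θ X)) ∼ proj₁ (proj₁ (η X))) →
    proj₁ (⟦ L′ ⟧ (T E) (λ X → proj₁ (θ X))) ∼ proj₁ (⟦ L′ ⟧ (T E) (λ X → proj₁ (η X)))

-- Such a T
-- is valid with R := ∼ itself, and sends two ∼-related valuations in U to
-- results ∼ the same source value, hence to ∼-related results. Conversely, if T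
-- is correct w.r.t. some R ⊆ ∼, then for ρ pick R-witnesses η′ of ρ; given
-- η ∼ ρ we have η ∼ η′ in U, so congruence moves ⟦T E⟧ η to ⟦T E⟧ η′, which is
-- ∼ ⟦E⟧ ρ by correctness w.r.t. R.
module Submission where

open import Defs
open import Level using (Level)
open import Data.Product using (_×_; _,_; proj₁; proj₂)
open import Function.Bundles using (_⇔_; mk⇔)
open import Relation.Unary using (Pred)
open import Relation.Binary.Core using (Rel)
open import Relation.Binary.Structures using (IsEquivalence)

module CorrectnessUpToEquivalence
  {ℓ : Level} {Var Z : Set ℓ} {V V′ : Pred Z ℓ}
  (L : Language Var V) (L′ : Language Var V′)
  {_∼_ : Rel Z ℓ} (isEquivalence : IsEquivalence _∼_)
  where

  open IsEquivalence isEquivalence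
  open Translations L L′

  semanticTranslation-mono : ∀ {R S : VRel} → (∀ v′ v → R v′ v → S v′ v) →
    IsSemanticTranslation R → IsSemanticTranslation S
  semanticTranslation-mono R⊆S semR v = proj₁ (semR v) , R⊆S _ _ (proj₂ (semR v))

  correct⇒congruence : ∀ {T} → CorrectWrt T (restrict _∼_) → IsCongruenceFor _∼_ T
  correct⇒congruence correct E θ η θ∼η =
    trans (correct E θ′ ρ θ′∼ρ) (sym (correct E η′ ρ η′∼ρ))
    where
    θ′ η′ : Var → Val V′
    θ′ X = proj₁ (θ X)
    η′ X = proj₁ (η X)
    ρ : Var → Val V
    ρ X = proj₁ (proj₂ (θ X))
    θ′∼ρ : θ′ ⟨ restrict _∼_ ⟩ᵛ ρ
    θ′∼ρ X = proj₂ (proj₂ (θ X))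
    η′∼ρ : η′ ⟨ restrict _∼_ ⟩ᵛ ρ
    η′∼ρ X = trans (sym (θ∼η X)) (θ′∼ρ X)

  correct⇒valid : ∀ {T} → CorrectUpTo T _∼_ → ValidUpTo T _∼_
  correct⇒valid (semantic , correct) = restrict _∼_ , semantic , (λ _ _ r → r) , correct

  valid∧congruence⇒correct : ∀ {T} → ValidUpTo T _∼_ → IsCongruenceFor _∼_ T →
    CorrectUpTo T _∼_
  valid∧congruence⇒correct {T} (R , semR , R⊆∼ , correctR) congruent =
    semanticTranslation-mono R⊆∼ semR , correct
    where
    correct : CorrectWrt T (restrict _∼_)
    correct E η ρ η∼ρ = trans (congruent E θ θ′ η∼η′) (R⊆∼ _ _ (correctR E η′ ρ η′Rρ))
      where
      η′ : Var → Val V′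
      η′ X = proj₁ (semR (ρ X))
      η′Rρ : η′ ⟨ R ⟩ᵛ ρ
      η′Rρ X = proj₂ (semR (ρ X))
      θ θ′ : Var → U _∼_
      θ X = η X , ρ X , η∼ρ X
      θ′ X = η′ X , ρ X , R⊆∼ _ _ (η′Rρ X)
      η∼η′ : ∀ X → proj₁ (η X) ∼ proj₁ (η′ X)
      η∼η′ X = trans (η∼ρ X) (sym (R⊆∼ _ _ (η′Rρ X)))

theorem1 : ∀ {ℓ : Level} {Var Z : Set ℓ} {V V′ : Pred Z ℓ}
    (L : Language Var V) (L′ : Language Var V′)
    (_∼_ : Rel Z ℓ) → IsEquivalence _∼_ →
    (T : Translations.Translation L L′) →
    Translations.CorrectUpTo L L′ T _∼_
      ⇔ (Translations.ValidUpTo L L′ T _∼_ × Translations.IsCongruenceFor L L′ _∼_ T)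
theorem1 L L′ _∼_ isEquivalence T = mk⇔
  (λ correct → correct⇒valid correct , correct⇒congruence (proj₂ correct))
  (λ (valid , congruent) → valid∧congruence⇒correct valid congruent)
  where open CorrectnessUpToEquivalence L L′ isEquivalence
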